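{- Let $\mathcal{C}$ be a sum closed permutation class. Let $F(x)=\sum_{n\ge0}f_nx^n$, $\widetilde F(x)=\sum_{n\ge1}\widetilde f_nx^n$ and $G(x)=\sum_{n\ge1}g_nx^n$, where $f_n=|\mathcal{C}_n|$ (so $f_0=1$), $\widetilde f_n=|\oplus\mathcal{C}_n|$, and $g_n$ is the number of indecomposable permutations in $\mathcal{C}_n$. Then, as formal power series, \[\widetilde F(x)=x\,G'(x)\,F(x)=\frac{xF'(x)}{F(x)}=x\frac{d}{dx}\log F(x).\]
   Context: A permutation class is a set of finite permutations closed under containment; $\mathcal{C}_n=\mathcal{C}\cap S_n$. For $\sigma\in S_a$ and $\tau\in S_b$, $\sigma\oplus\tau\in S_{a+b}$ equals $\sigma(i)$ for $i\le a$ and $a+\tau(i-a)$ for $i>a$. The class is sum closed if it is closed under $\oplus$. A permutation is indecomposable if it is not a sum of two permutations of nonzero size. For $\pi\in S_n$, $\oplus\pi(i+kn)=\pi(i)+kn$ for $i\in[n]$ and $k\in\mathbb{Z}$. The shift is $\Sigma^r\sigma(i)=\sigma(i-r)+r$. We set $\oplus\mathcal{C}_n=\{\Sigma^r(\oplus\pi):\pi\in\mathcal{C}_n,\ r\in\mathbb{Z}\}$, viewed as a set of bijections $\mathbb{Z}\to\mathbb{Z}$. -}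

module Defs where

open import Data.Nat as ℕ using (ℕ; zero; suc; _+_; _*_; _∸_)
open import Data.Integer as ℤ using (ℤ; +_)
open import Data.Integer.DivMod using (_/ℕ_; _%ℕ_; n%ℕd<d)
open import Data.Fin as Fin using (Fin; toℕ; fromℕ<; splitAt; _↑ˡ_; _↑ʳ_)
open import Data.Vec using (Vec; []; lookup; tabulate)
open import Data.Product using (Σ; ∃; _×_; _,_)
open import Data.Sum using ([_,_])
open import Relation.Nullary using (¬_)
open import Relation.Binary.PropositionalEquality using (_≡_; subst)
open import Function.Bundles using (_⇔_)

-- Permutations of size n in one-line notation: a vector v of length n
-- with entries in Fin n (0-indexed), i.e. the map i ↦ lookup v i.

Word : ℕ → Set
Word n = Vec (Fin n) n

IsPerm : ∀ {n} → Word n → Set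
IsPerm {n} v = (∀ i j → lookup v i ≡ lookup v j → i ≡ j)
             × (∀ y → ∃ λ i → lookup v i ≡ y)

Contains : ∀ {n k} → Word n → Word k → Set
Contains {n} {k} π σ =
  Σ (Fin k → Fin n) λ e →
    (∀ a b → a Fin.< b → e a Fin.< e b)
    × (∀ a b → (lookup σ a Fin.< lookup σ b) ⇔ (lookup π (e a) Fin.< lookup π (e b)))

_⊕_ : ∀ {a b} → Word a → Word b → Word (a + b)
_⊕_ {a} {b} σ τ =
  tabulate λ i → [ (λ j → lookup σ j ↑ˡ b) , (λ j → a ↑ʳ lookup τ j) ] (splitAt a i)

Class : Set₁
Class = (n : ℕ) → Word n → Set

IsPermClass : Class → Set
IsPermClass C =
  (∀ n (v : Word n) → C n v → IsPerm v)
  × (∀ n k (π : Word n) (σ : Word k) → C n π → IsPerm σ → Contains π σ → C k σ)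

SumClosed : Class → Set
SumClosed C = ∀ a b (σ : Word a) (τ : Word b) → C a σ → C b τ → C (a + b) (σ ⊕ τ)

Indecomposable : ∀ {n} → Word n → Set
Indecomposable {n} π =
  ¬ (Σ ℕ λ a → Σ ℕ λ b → Σ (Word (suc a)) λ σ → Σ (Word (suc b)) λ τ →
       IsPerm σ × IsPerm τ ×
       Σ (suc a + suc b ≡ n) λ e → subst Word e (σ ⊕ τ) ≡ π)

Card : {A : Set} → (A → A → Set) → (A → Set) → ℕ → Set
Card {A} _≈_ P k =
  Σ (Vec A k) λ xs →
    (∀ i → P (lookup xs i))
    × (∀ i j → lookup xs i ≈ lookup xs j → i ≡ j)
    × (∀ a → P a → ∃ λ i → a ≈ lookup xs i)

_≗ℤ_ : (ℤ → ℤ) → (ℤ → ℤ) → Set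
f ≗ℤ g = ∀ i → f i ≡ g i

-- ⊕π for π ∈ S_{m+1}, with positions/values 1-indexed as in the paper:
-- writing i = j + k(m+1) with j ∈ [1, m+1], ⊕π(i) = π(j) + k(m+1).
-- Here j - 1 = (i - 1) mod (m+1), k = (i - 1) div (m+1).

oplusZ : ∀ {m} → Word (suc m) → ℤ → ℤ
oplusZ {m} π i =
  let i′ = i ℤ.- + 1
      j  = fromℕ< (n%ℕd<d i′ (suc m))
      k  = i′ /ℕ suc m
  in (+ toℕ (lookup π j) ℤ.+ + 1) ℤ.+ k ℤ.* + suc m

shiftZ : ℤ → (ℤ → ℤ) → ℤ → ℤ
shiftZ r σ i = σ (i ℤ.- r) ℤ.+ r

OplusClass : Class → (m : ℕ) → (ℤ → ℤ) → Set
OplusClass C m h =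
  Σ (Word (suc m)) λ π → C (suc m) π × Σ ℤ λ r → h ≗ℤ shiftZ r (oplusZ π)

FPS : Set
FPS = ℕ → ℕ

sumBelow : ℕ → (ℕ → ℕ) → ℕ
sumBelow zero    a = 0
sumBelow (suc n) a = sumBelow n a + a n

_·_ : FPS → FPS → FPS
(a · b) n = sumBelow (suc n) λ k → a k * b (n ∸ k)

D : FPS → FPS
D a n = suc n * a (suc n)

X : FPS → FPS
X a zero    = 0
X a (suc n) = a n

pos : FPS → FPS
pos a zero    = 0
pos a (suc n) = a (suc n)

module Submission where

open import Defs
open import Data.Nat using (ℕ; suc; zero; _+_; _*_; _∸_; _≤_; _<_; s≤s; z<s)
open import Data.Vec using ([]; lookup; tabulate)
open import Data.Product using (_×_; Σ; _,_; proj₁; proj₂)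
open import Relation.Binary.PropositionalEquality
  using (_≡_; _≢_; refl; sym; trans; cong; cong₂; subst; subst₂; module ≡-Reasoning)

open import Data.Nat.Induction using (<-rec)
import Data.Nat.Properties as NP
open import Algebra.Properties.CommutativeSemigroup NP.+-commutativeSemigroup using () renaming (interchange to +-interchange)
open import Data.Fin as F using (Fin; toℕ; fromℕ<; splitAt; _↑ˡ_; _↑ʳ_; join; combine; remQuot)
import Data.Fin.Properties as FP
import Data.Vec.Properties as VP
open import Data.Sum using (_⊎_; inj₁; inj₂; [_,_])
open import Function.Bundles using (mk⇔)
open import Data.Empty using (⊥; ⊥-elim)
open import Relation.Nullary using (¬_; Dec; yes; no)
open import Relation.Nullary.Decidable using (_×-dec_; _→-dec_)
open import Relation.Binary.Definitions using (tri<; tri≈; tri>)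
open import Data.Integer as Z using (ℤ; +_; -[1+_]; _⊖_)
import Data.Integer.Properties as ZP
open import Data.Integer.Tactic.RingSolver using (solve-∀)
open import Data.Integer.DivMod using (_/ℕ_; _%ℕ_; n%ℕd<d; a≡a%ℕn+[a/ℕn]*n)

-- Idea.  Every nonempty π ∈ C splits uniquely as α ⊕ ρ where α is the block
-- of π up to its first cut; α is indecomposable and α, ρ ∈ C.  Hence
-- f(m+1) = Σ_{k≤m} g(k+1)·f(m−k), i.e. F = 1 + G·F.  The bijections of
-- ⊕C_{m+1} are exactly the Σ^{-t}(⊕(α ⊕ ρ)) with 0 ≤ t ≤ k = |α| − 1, each
-- obtained once: two different t would create a cut inside α, and any shift
-- Σ^{-u}(⊕π) with u > k reduces to a smaller shift of ⊕(ρ ⊕ α) ∈ ⊕C.  Hence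
-- f̃(m+1) = Σ_{k≤m} (k+1)·g(k+1)·f(m−k), i.e. F̃ = x·G′·F.  Finally,
-- differentiating F = 1 + G·F gives F′ = G′·F·F, so F̃·F = x·G′·F·F = x·F′.

-- Finite sets up to an equivalence.

record Finite : Set₁ where
  field
    Elem     : Set
    _∼_      : Elem → Elem → Set
    size     : ℕ
    enum     : Fin size → Elem
    enum-inj : ∀ {i j} → enum i ∼ enum j → i ≡ j
    code     : Elem → Fin size
    code-inj : ∀ {x y} → code x ≡ code y → x ∼ y
open Finite

-- Bijection principle: a map φ : A → B that preserves and reflects the
-- relations and is surjective up to '_∼_' of B forces |A| = |B|.
-- Both inequalities come from injections into 'Fin'.
size-≡ : (A B : Finite) (φ : Elem A → Elem B)
  → (∀ {x y} → _∼_ B (φ x) (φ y) → _∼_ A x y)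
  → (∀ {x y} → _∼_ A x y → _∼_ B (φ x) (φ y))
  → (∀ y → Σ (Elem A) λ x → _∼_ B (φ x) y)
  → (∀ {x y} → _∼_ B x y → _∼_ B y x)
  → (∀ {x y z} → _∼_ B x y → _∼_ B y z → _∼_ B x z)
  → size A ≡ size B
size-≡ A B φ reflects preserves surj sym-B trans-B = NP.≤-antisym A≤B B≤A
  where
  A≤B : size A ≤ size B
  A≤B = FP.injective⇒≤ {f = λ i → code B (φ (enum A i))}
    λ eq → enum-inj A (reflects (code-inj B eq))
  preimage : Fin (size B) → Elem A
  preimage j = proj₁ (surj (enum B j))
  B≤A : size B ≤ size A
  B≤A = FP.injective⇒≤ {f = λ j → code A (preimage j)}
    λ {j₁} {j₂} eq → enum-inj B (trans-B (sym-B (proj₂ (surj (enum B j₁))))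
                       (trans-B (preserves (code-inj A eq)) (proj₂ (surj (enum B j₂)))))

fromCard : {A : Set} (_≈_ : A → A → Set) (P : A → Set) (k : ℕ)
  → (∀ {x y} → x ≈ y → y ≈ x) → (∀ {x y z} → x ≈ y → y ≈ z → x ≈ z)
  → Card _≈_ P k → Finite
fromCard {A} _≈_ P k sym-≈ trans-≈ (xs , inP , inj , surj) = record
  { Elem     = Σ A P
  ; _∼_      = λ x y → proj₁ x ≈ proj₁ y
  ; size     = k
  ; enum     = λ i → lookup xs i , inP i
  ; enum-inj = λ {i} {j} → inj i j
  ; code     = index
  ; code-inj = λ {x} {y} eq → trans-≈ (at x)
                 (sym-≈ (subst (λ i → proj₁ y ≈ lookup xs i) (sym eq) (at y)))
  }
  where
  index : Σ A P → Fin k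
  index (a , p) = proj₁ (surj a p)
  at : ∀ x → proj₁ x ≈ lookup xs (index x)
  at (a , p) = proj₂ (surj a p)

finite-Fin : ℕ → Finite
finite-Fin n = record { Elem = Fin n ; _∼_ = _≡_ ; size = n ; enum = λ i → i ; enum-inj = λ e → e
                      ; code = λ i → i ; code-inj = λ e → e }

_×ᶠ_ : Finite → Finite → Finite
A ×ᶠ B = record
  { Elem     = Elem A × Elem B
  ; _∼_      = λ x y → _∼_ A (proj₁ x) (proj₁ y) × _∼_ B (proj₂ x) (proj₂ y)
  ; size     = size A * size B
  ; enum     = λ i → enum A (proj₁ (split i)) , enum B (proj₂ (split i))
  ; enum-inj = λ {i} {j} e →
      trans (sym (FP.combine-remQuot {size A} (size B) i))
        (trans (cong₂ combine (enum-inj A (proj₁ e)) (enum-inj B (proj₂ e)))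
               (FP.combine-remQuot {size A} (size B) j))
  ; code     = λ x → combine (code A (proj₁ x)) (code B (proj₂ x))
  ; code-inj = λ {x} {y} e →
      let e′ = trans (sym (FP.remQuot-combine (code A (proj₁ x)) (code B (proj₂ x))))
                 (trans (cong split e) (FP.remQuot-combine (code A (proj₁ y)) (code B (proj₂ y))))
      in code-inj A (cong proj₁ e′) , code-inj B (cong proj₂ e′)
  }
  where
  split : Fin (size A * size B) → Fin (size A) × Fin (size B)
  split = remQuot {size A} (size B)

module DisjointUnion (G : ℕ → Finite) where

  Below : ℕ → Set
  Below n = Σ ℕ λ k → (k < n) × Elem (G k)

  _≋_ : ∀ {n} → Below n → Below n → Set
  (k , _ , x) ≋ (k′ , _ , y) = Σ (k ≡ k′) λ e → _∼_ (G k′) (subst (λ k → Elem (G k)) e x) y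

  totalSize : ℕ → ℕ
  totalSize n = sumBelow n (λ k → size (G k))

  weaken : ∀ {n} → Below n → Below (suc n)
  weaken (k , p , x) = k , NP.m≤n⇒m≤1+n p , x

  enumBelow : ∀ n → Fin (totalSize n) → Below n
  enumBelow (suc n) i with splitAt (totalSize n) i
  ... | inj₁ j = weaken (enumBelow n j)
  ... | inj₂ j = n , NP.≤-refl , enum (G n) j

  join-splitAt-≡ : ∀ {a b} (i j : Fin (a + b)) → splitAt a i ≡ splitAt a j → i ≡ j
  join-splitAt-≡ {a} {b} i j e =
    trans (sym (FP.join-splitAt a b i)) (trans (cong (join a b) e) (FP.join-splitAt a b j))

  enumBelow-inj : ∀ n {i j} → enumBelow n i ≋ enumBelow n j → i ≡ j
  enumBelow-inj (suc n) {i} {j} r with splitAt (totalSize n) i in ei | splitAt (totalSize n) j in ej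
  ... | inj₁ a | inj₁ b = join-splitAt-≡ i j (trans ei (trans (cong inj₁ (enumBelow-inj n r)) (sym ej)))
  ... | inj₂ a | inj₂ b with r
  ... | refl , r′ = join-splitAt-≡ i j (trans ei (trans (cong inj₂ (enum-inj (G n) r′)) (sym ej)))
  enumBelow-inj (suc n) (e , _) | inj₁ a | inj₂ b = ⊥-elim (NP.<-irrefl e (proj₁ (proj₂ (enumBelow n a))))
  enumBelow-inj (suc n) (e , _) | inj₂ a | inj₁ b = ⊥-elim (NP.<-irrefl (sym e) (proj₁ (proj₂ (enumBelow n b))))

  last-index : ∀ {k n} → k < suc n → ¬ (k < n) → k ≡ n
  last-index p q = NP.≤-antisym (NP.≤-pred p) (NP.≮⇒≥ q)

  codeLast : ∀ n k → Elem (G k) → k ≡ n → Fin (totalSize (suc n))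
  codeLast n k x e = totalSize n ↑ʳ code (G n) (subst (λ k → Elem (G k)) e x)

  codeBelow : ∀ n → Below n → Fin (totalSize n)
  codeBelow (suc n) (k , p , x) with k NP.<? n
  ... | yes q = codeBelow n (k , q , x) ↑ˡ size (G n)
  ... | no q  = codeLast n k x (last-index p q)

  codeLast-inj : ∀ n k k′ x y (e₁ : k ≡ n) (e₂ : k′ ≡ n) (p : k < suc n) (p′ : k′ < suc n)
    → codeLast n k x e₁ ≡ codeLast n k′ y e₂ → _≋_ {suc n} (k , p , x) (k′ , p′ , y)
  codeLast-inj n k k′ x y refl refl p p′ e = refl , code-inj (G n) (FP.↑ʳ-injective (totalSize n) _ _ e)

  ↑ˡ≢↑ʳ : ∀ {a b} (i : Fin a) (j : Fin b) → i ↑ˡ b ≢ a ↑ʳ j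
  ↑ˡ≢↑ʳ {a} {b} i j e = NP.<⇒≱ (subst (_< a) (sym (FP.toℕ-↑ˡ i b)) (FP.toℕ<n i))
    (subst (a ≤_) (sym (trans (cong toℕ e) (FP.toℕ-↑ʳ a j))) (NP.m≤m+n a (toℕ j)))

  codeBelow-inj : ∀ n {x y} → codeBelow n x ≡ codeBelow n y → x ≋ y
  codeBelow-inj (suc n) {k , p , x} {k′ , p′ , y} e with k NP.<? n | k′ NP.<? n
  ... | yes q | yes q′ = codeBelow-inj n (FP.↑ˡ-injective (size (G n)) _ _ e)
  ... | no q  | no q′  = codeLast-inj n k k′ x y (last-index p q) (last-index p′ q′) p p′ e
  ... | yes q | no q′  = ⊥-elim (↑ˡ≢↑ʳ _ _ e)
  ... | no q  | yes q′ = ⊥-elim (↑ˡ≢↑ʳ _ _ (sym e))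

  finite-Below : ℕ → Finite
  finite-Below n = record { Elem = Below n ; _∼_ = _≋_ ; size = totalSize n
                          ; enum = enumBelow n ; enum-inj = enumBelow-inj n
                          ; code = codeBelow n ; code-inj = codeBelow-inj n }

-- Algebra of formal power series with coefficients in ℕ.  The identity
-- F̃·F = x F′ follows from F̃ = x G′F (proved combinatorially) together with
-- F′ = G′·F·F, which is derived here from F = 1 + G·F alone: both sides of
-- the latter solve H = G′F + G·H, whose solution is unique as G(0) = 0.

_≐_ : FPS → FPS → Set
a ≐ b = ∀ n → a n ≡ b n

_⊞_ : FPS → FPS → FPS
(a ⊞ b) n = a n + b n

one : FPS
one zero    = 1
one (suc n) = 0

sum-cong : ∀ n {a b : ℕ → ℕ} → (∀ k → k < n → a k ≡ b k) → sumBelow n a ≡ sumBelow n b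
sum-cong zero    h = refl
sum-cong (suc n) h = cong₂ _+_ (sum-cong n (λ k p → h k (NP.m≤n⇒m≤1+n p))) (h n NP.≤-refl)

sum-+ : ∀ n (a b : ℕ → ℕ) → sumBelow n (λ k → a k + b k) ≡ sumBelow n a + sumBelow n b
sum-+ zero    a b = refl
sum-+ (suc n) a b = trans (cong (_+ (a n + b n)) (sum-+ n a b))
                          (+-interchange (sumBelow n a) (sumBelow n b) (a n) (b n))

sum-*ˡ : ∀ n c (a : ℕ → ℕ) → c * sumBelow n a ≡ sumBelow n (λ k → c * a k)
sum-*ˡ zero    c a = NP.*-zeroʳ c
sum-*ˡ (suc n) c a = trans (NP.*-distribˡ-+ c (sumBelow n a) (a n)) (cong (_+ c * a n) (sum-*ˡ n c a))

sum-zero : ∀ n → sumBelow n (λ _ → 0) ≡ 0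
sum-zero zero    = refl
sum-zero (suc n) = trans (NP.+-identityʳ _) (sum-zero n)

sum-first : ∀ n (a : ℕ → ℕ) → sumBelow (suc n) a ≡ a 0 + sumBelow n (λ k → a (suc k))
sum-first zero    a = sym (NP.+-identityʳ (a 0))
sum-first (suc n) a = trans (cong (_+ a (suc n)) (sum-first n a)) (NP.+-assoc (a 0) _ _)

sum-reverse : ∀ n (a : ℕ → ℕ) → sumBelow (suc n) a ≡ sumBelow (suc n) (λ k → a (n ∸ k))
sum-reverse zero    a = refl
sum-reverse (suc n) a = trans (cong (_+ a (suc n)) (sum-reverse n a))
  (trans (NP.+-comm _ (a (suc n))) (sym (sum-first (suc n) (λ k → a (suc n ∸ k)))))

sum-triangle : ∀ n (H : ℕ → ℕ → ℕ) →
  sumBelow (suc n) (λ i → sumBelow (suc i) (λ j → H j i))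
  ≡ sumBelow (suc n) (λ j → sumBelow (suc (n ∸ j)) (λ l → H j (j + l)))
sum-triangle zero    H = refl
sum-triangle (suc n) H = begin
    rows n + (column + H (suc n) (suc n))
  ≡⟨ cong (_+ (column + H (suc n) (suc n))) (sum-triangle n H) ⟩
    cols n + (column + H (suc n) (suc n))
  ≡⟨ sym (NP.+-assoc (cols n) column _) ⟩
    (cols n + column) + H (suc n) (suc n)
  ≡⟨ cong₂ _+_ (sym (sum-+ (suc n) _ _)) corner ⟩
    sumBelow (suc n) (λ j → sumBelow (suc (n ∸ j)) (λ l → H j (j + l)) + H j (suc n))
      + sumBelow (suc (suc n ∸ suc n)) (λ l → H (suc n) (suc n + l))
  ≡⟨ cong (_+ sumBelow (suc (suc n ∸ suc n)) (λ l → H (suc n) (suc n + l)))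
          (sum-cong (suc n) λ j p → sym (longer-row j (NP.≤-pred p))) ⟩
    cols (suc n)
  ∎
  where
  open ≡-Reasoning
  rows cols : ℕ → ℕ
  rows n = sumBelow (suc n) (λ i → sumBelow (suc i) (λ j → H j i))
  cols n = sumBelow (suc n) (λ j → sumBelow (suc (n ∸ j)) (λ l → H j (j + l)))
  column : ℕ
  column = sumBelow (suc n) (λ j → H j (suc n))
  corner : H (suc n) (suc n) ≡ sumBelow (suc (suc n ∸ suc n)) (λ l → H (suc n) (suc n + l))
  corner = trans (cong (H (suc n)) (sym (NP.+-identityʳ (suc n))))
                 (cong (λ z → sumBelow (suc z) (λ l → H (suc n) (suc n + l))) (sym (NP.n∸n≡0 n)))
  longer-row : ∀ j → j ≤ n → sumBelow (suc (suc n ∸ j)) (λ l → H j (j + l))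
                             ≡ sumBelow (suc (n ∸ j)) (λ l → H j (j + l)) + H j (suc n)
  longer-row j p = trans (cong (λ z → sumBelow (suc z) (λ l → H j (j + l))) (NP.+-∸-assoc 1 p))
    (cong (λ z → sumBelow (suc (n ∸ j)) (λ l → H j (j + l)) + H j z)
          (trans (NP.+-suc j (n ∸ j)) (cong suc (NP.m+[n∸m]≡n p))))

·-cong : ∀ {a a′ b b′} → a ≐ a′ → b ≐ b′ → (a · b) ≐ (a′ · b′)
·-cong ha hb n = sum-cong (suc n) λ k _ → cong₂ _*_ (ha k) (hb (n ∸ k))

·-comm : ∀ a b → (a · b) ≐ (b · a)
·-comm a b n = trans (sum-reverse n _) (sum-cong (suc n) λ k p →
  trans (cong (λ z → a (n ∸ k) * b z) (NP.m∸[m∸n]≡n (NP.≤-pred p))) (NP.*-comm (a (n ∸ k)) (b k)))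

·-distribˡ-⊞ : ∀ a b c → (a · (b ⊞ c)) ≐ ((a · b) ⊞ (a · c))
·-distribˡ-⊞ a b c n =
  trans (sum-cong (suc n) (λ k _ → NP.*-distribˡ-+ (a k) (b (n ∸ k)) (c (n ∸ k)))) (sum-+ (suc n) _ _)

·-assoc : ∀ a b c → ((a · b) · c) ≐ (a · (b · c))
·-assoc a b c n =
  trans (sum-cong (suc n) (λ i _ → trans (NP.*-comm _ (c (n ∸ i)))
           (trans (sum-*ˡ (suc i) (c (n ∸ i)) _) (sum-cong (suc i) λ j _ → NP.*-comm (c (n ∸ i)) _))))
  (trans (sum-triangle n (λ j i → (a j * b (i ∸ j)) * c (n ∸ i)))
  (sum-cong (suc n) λ j p → trans (sum-cong (suc (n ∸ j)) (λ l q →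
     trans (cong₂ (λ x y → (a j * b x) * c y) (NP.m+n∸m≡n j l) (sym (NP.∸-+-assoc n j l)))
           (NP.*-assoc (a j) _ _)))
     (sym (sum-*ˡ (suc (n ∸ j)) (a j) _))))

·-one : ∀ a → (a · one) ≐ a
·-one a n = trans (·-comm a one n) (trans (sum-first n _)
  (trans (cong (λ z → a n + 0 + z) (sum-zero n)) (trans (NP.+-identityʳ _) (NP.+-identityʳ _))))

-- Leibniz rule (A·B)′ = A′·B + A·B′, from (n+1) = k + (n+1-k) in each term.
leibniz : ∀ A B → D (A · B) ≐ ((D A · B) ⊞ (A · D B))
leibniz A B n = begin
    suc n * sumBelow (suc (suc n)) (λ k → A k * B (suc n ∸ k))
  ≡⟨ sum-*ˡ (suc (suc n)) (suc n) _ ⟩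
    sumBelow (suc (suc n)) (λ k → suc n * (A k * B (suc n ∸ k)))
  ≡⟨ sum-cong (suc (suc n)) (λ k p →
       trans (cong (_* (A k * B (suc n ∸ k))) (sym (NP.m+[n∸m]≡n (NP.≤-pred p))))
             (NP.*-distribʳ-+ (A k * B (suc n ∸ k)) k (suc n ∸ k))) ⟩
    sumBelow (suc (suc n)) (λ k → k * (A k * B (suc n ∸ k)) + (suc n ∸ k) * (A k * B (suc n ∸ k)))
  ≡⟨ sum-+ (suc (suc n)) _ _ ⟩
    sumBelow (suc (suc n)) (λ k → k * (A k * B (suc n ∸ k)))
      + sumBelow (suc (suc n)) (λ k → (suc n ∸ k) * (A k * B (suc n ∸ k)))
  ≡⟨ cong₂ _+_ derivative-left derivative-right ⟩
    (D A · B) n + (A · D B) n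
  ∎
  where
  open ≡-Reasoning
  derivative-left : sumBelow (suc (suc n)) (λ k → k * (A k * B (suc n ∸ k))) ≡ (D A · B) n
  derivative-left = trans (sum-first (suc n) _) (sum-cong (suc n) λ k _ → sym (NP.*-assoc (suc k) (A (suc k)) _))
  rearrange : ∀ k → (suc n ∸ k) * (A k * B (suc n ∸ k)) ≡ A k * ((suc n ∸ k) * B (suc n ∸ k))
  rearrange k = trans (sym (NP.*-assoc (suc n ∸ k) (A k) _))
    (trans (cong (_* B (suc n ∸ k)) (NP.*-comm (suc n ∸ k) (A k))) (NP.*-assoc (A k) _ _))
  derivative-right : sumBelow (suc (suc n)) (λ k → (suc n ∸ k) * (A k * B (suc n ∸ k))) ≡ (A · D B) n
  derivative-right =
    trans (cong (_+_ (sumBelow (suc n) (λ k → (suc n ∸ k) * (A k * B (suc n ∸ k)))))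
                (cong (λ z → z * (A (suc n) * B z)) (NP.n∸n≡0 n)))
    (trans (NP.+-identityʳ _) (sum-cong (suc n) λ k p →
      trans (rearrange k) (cong (λ z → A k * (z * B z)) (NP.+-∸-assoc 1 (NP.≤-pred p)))))

·-first : ∀ a b n → (a · b) n ≡ a 0 * b n + sumBelow n (λ j → a (suc j) * b (n ∸ suc j))
·-first a b n = sum-first n _

-- If G(0) = 0, the equation H = Q + G·H has at most one solution: its
-- n-th coefficient is determined by the coefficients below n.
solution-unique : ∀ (G Q H₁ H₂ : FPS) → G 0 ≡ 0
  → H₁ ≐ (Q ⊞ (G · H₁)) → H₂ ≐ (Q ⊞ (G · H₂)) → H₁ ≐ H₂
solution-unique G Q H₁ H₂ g₀ e₁ e₂ = <-rec (λ n → H₁ n ≡ H₂ n) step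
  where
  step : ∀ n → (∀ {k} → k < n → H₁ k ≡ H₂ k) → H₁ n ≡ H₂ n
  step n ih = begin
      H₁ n                                                          ≡⟨ e₁ n ⟩
      Q n + (G · H₁) n                                              ≡⟨ cong (_+_ (Q n)) (·-first G H₁ n) ⟩
      Q n + (G 0 * H₁ n + sumBelow n (λ j → G (suc j) * H₁ (n ∸ suc j)))
        ≡⟨ cong₂ (λ x y → Q n + (x + y)) (cong (_* H₁ n) g₀)
                 (sum-cong n λ j p → cong (G (suc j) *_) (ih (NP.∸-monoʳ-< {n} {suc j} {0} z<s p))) ⟩
      Q n + (0 * H₂ n + sumBelow n (λ j → G (suc j) * H₂ (n ∸ suc j)))
        ≡⟨ cong (λ x → Q n + (x * H₂ n + sumBelow n (λ j → G (suc j) * H₂ (n ∸ suc j)))) (sym g₀) ⟩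
      Q n + (G 0 * H₂ n + sumBelow n (λ j → G (suc j) * H₂ (n ∸ suc j)))
        ≡⟨ cong (_+_ (Q n)) (sym (·-first G H₂ n)) ⟩
      Q n + (G · H₂) n                                              ≡⟨ sym (e₂ n) ⟩
      H₂ n                                                          ∎
    where open ≡-Reasoning

derivative-of-renewal : ∀ (F G : FPS) → G 0 ≡ 0 → F ≐ (one ⊞ (G · F)) → D F ≐ ((D G · F) · F)
derivative-of-renewal F G g₀ renewal = solution-unique G Q (D F) (Q · F) g₀ DF-solves QF-solves
  where
  Q : FPS
  Q = D G · F
  DF-solves : D F ≐ (Q ⊞ (G · D F))
  DF-solves n = trans (cong (suc n *_) (renewal (suc n))) (leibniz G F n)
  QF-solves : (Q · F) ≐ (Q ⊞ (G · (Q · F)))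
  QF-solves n = trans (·-cong {Q} {Q} (λ _ → refl) renewal n) (trans (·-distribˡ-⊞ Q one (G · F) n)
    (cong₂ _+_ (·-one Q n) (trans (sym (·-assoc Q G F n))
      (trans (·-cong {Q · G} {G · Q} {F} {F} (·-comm Q G) (λ _ → refl) n) (·-assoc G Q F n)))))

-- Words as functions ℕ → ℕ.  All reasoning about positions and values of a
-- permutation is done in ℕ: 'val π j' is the (0-indexed) value at position
-- j < n, and 0 outside the word.

val : ∀ {n} → Word n → ℕ → ℕ
val {n} v j with j NP.<? n
... | yes p = toℕ (lookup v (fromℕ< p))
... | no _  = 0

val-lookup : ∀ {n} (v : Word n) {j} (p : j < n) → val v j ≡ toℕ (lookup v (fromℕ< p))
val-lookup {n} v {j} p with j NP.<? n
... | yes q = cong (λ i → toℕ (lookup v i)) (FP.fromℕ<-cong j j refl q p)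
... | no q  = ⊥-elim (q p)

val-toℕ : ∀ {n} (v : Word n) (i : Fin n) → val v (toℕ i) ≡ toℕ (lookup v i)
val-toℕ v i = trans (val-lookup v (FP.toℕ<n i)) (cong (λ i → toℕ (lookup v i)) (FP.fromℕ<-toℕ i (FP.toℕ<n i)))

val< : ∀ {n} (v : Word n) {j} → j < n → val v j < n
val< v p = subst (_< _) (sym (val-lookup v p)) (FP.toℕ<n _)

word-ext : ∀ {n} (v w : Word n) → (∀ j → j < n → val v j ≡ val w j) → v ≡ w
word-ext v w h = trans (sym (VP.tabulate∘lookup v)) (trans (VP.tabulate-cong values) (VP.tabulate∘lookup w))
  where
  values : ∀ i → lookup v i ≡ lookup w i
  values i = FP.toℕ-injective (trans (sym (val-toℕ v i)) (trans (h (toℕ i) (FP.toℕ<n i)) (val-toℕ w i)))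

IsPermℕ : ∀ {n} → Word n → Set
IsPermℕ {n} v = (∀ i j → i < n → j < n → val v i ≡ val v j → i ≡ j)
              × (∀ y → y < n → Σ ℕ λ i → (i < n) × (val v i ≡ y))

isPerm⇒ℕ : ∀ {n} (v : Word n) → IsPerm v → IsPermℕ v
isPerm⇒ℕ {n} v (inj , surj) =
  (λ i j p q e → trans (sym (FP.toℕ-fromℕ< p)) (trans (cong toℕ (inj _ _ (FP.toℕ-injective
      (trans (sym (val-lookup v p)) (trans e (val-lookup v q)))))) (FP.toℕ-fromℕ< q)))
  , λ y p → let (i , e) = surj (fromℕ< p) in
      toℕ i , FP.toℕ<n i , trans (val-toℕ v i) (trans (cong toℕ e) (FP.toℕ-fromℕ< p))

isPermℕ⇒ : ∀ {n} (v : Word n) → IsPermℕ v → IsPerm v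
isPermℕ⇒ {n} v (inj , surj) =
  (λ i j e → FP.toℕ-injective (inj (toℕ i) (toℕ j) (FP.toℕ<n i) (FP.toℕ<n j)
       (trans (val-toℕ v i) (trans (cong toℕ e) (sym (val-toℕ v j))))))
  , λ y → let (i , p , e) = surj (toℕ y) (FP.toℕ<n y) in
      fromℕ< p , FP.toℕ-injective (trans (sym (val-lookup v p)) e)

lookup-⊕ˡ : ∀ {a b} (σ : Word a) (τ : Word b) (i : Fin a) → lookup (σ ⊕ τ) (i ↑ˡ b) ≡ lookup σ i ↑ˡ b
lookup-⊕ˡ {a} {b} σ τ i =
  trans (VP.lookup∘tabulate _ (i ↑ˡ b)) (cong [ (λ j → lookup σ j ↑ˡ b) , (λ j → a ↑ʳ lookup τ j) ] (FP.splitAt-↑ˡ a i b))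

lookup-⊕ʳ : ∀ {a b} (σ : Word a) (τ : Word b) (i : Fin b) → lookup (σ ⊕ τ) (a ↑ʳ i) ≡ a ↑ʳ lookup τ i
lookup-⊕ʳ {a} {b} σ τ i =
  trans (VP.lookup∘tabulate _ (a ↑ʳ i)) (cong [ (λ j → lookup σ j ↑ˡ b) , (λ j → a ↑ʳ lookup τ j) ] (FP.splitAt-↑ʳ a b i))

val-⊕ˡ : ∀ {a b} (σ : Word a) (τ : Word b) {j} → j < a → val (σ ⊕ τ) j ≡ val σ j
val-⊕ˡ {a} {b} σ τ {j} p = begin
  val (σ ⊕ τ) j                         ≡⟨ cong (val (σ ⊕ τ)) (sym (trans (FP.toℕ-↑ˡ i b) (FP.toℕ-fromℕ< p))) ⟩
  val (σ ⊕ τ) (toℕ (i ↑ˡ b))            ≡⟨ val-toℕ (σ ⊕ τ) (i ↑ˡ b) ⟩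
  toℕ (lookup (σ ⊕ τ) (i ↑ˡ b))         ≡⟨ cong toℕ (lookup-⊕ˡ σ τ i) ⟩
  toℕ (lookup σ i ↑ˡ b)                 ≡⟨ FP.toℕ-↑ˡ _ b ⟩
  toℕ (lookup σ i)                      ≡⟨ sym (val-lookup σ p) ⟩
  val σ j                               ∎
  where
  open ≡-Reasoning
  i = fromℕ< p

val-⊕ʳ : ∀ {a b} (σ : Word a) (τ : Word b) {j} → j < b → val (σ ⊕ τ) (a + j) ≡ a + val τ j
val-⊕ʳ {a} {b} σ τ {j} p = begin
  val (σ ⊕ τ) (a + j)                   ≡⟨ cong (val (σ ⊕ τ)) (sym (trans (FP.toℕ-↑ʳ a i) (cong (_+_ a) (FP.toℕ-fromℕ< p)))) ⟩
  val (σ ⊕ τ) (toℕ (a ↑ʳ i))            ≡⟨ val-toℕ (σ ⊕ τ) (a ↑ʳ i) ⟩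
  toℕ (lookup (σ ⊕ τ) (a ↑ʳ i))         ≡⟨ cong toℕ (lookup-⊕ʳ σ τ i) ⟩
  toℕ (a ↑ʳ lookup τ i)                 ≡⟨ FP.toℕ-↑ʳ a _ ⟩
  a + toℕ (lookup τ i)                  ≡⟨ cong (_+_ a) (sym (val-lookup τ p)) ⟩
  a + val τ j                           ∎
  where
  open ≡-Reasoning
  i = fromℕ< p

∸-< : ∀ {a b x} → a ≤ x → x < a + b → x ∸ a < b
∸-< {a} {b} p q = subst (_ <_) (NP.m+n∸m≡n a b) (NP.∸-monoˡ-< q p)

val-⊕ʳ′ : ∀ {a b} (σ : Word a) (τ : Word b) {j} → a ≤ j → j < a + b → val (σ ⊕ τ) j ≡ a + val τ (j ∸ a)
val-⊕ʳ′ {a} σ τ {j} p q = trans (cong (val (σ ⊕ τ)) (sym (NP.m+[n∸m]≡n p))) (val-⊕ʳ σ τ (∸-< p q))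

≤val-⊕ʳ : ∀ {a b} (σ : Word a) (τ : Word b) {j} → a ≤ j → j < a + b → a ≤ val (σ ⊕ τ) j
≤val-⊕ʳ {a} σ τ p q = subst (a ≤_) (sym (val-⊕ʳ′ σ τ p q)) (NP.m≤m+n a _)

⊕-injective : ∀ {a b} (σ σ′ : Word a) (τ τ′ : Word b) → σ ⊕ τ ≡ σ′ ⊕ τ′ → (σ ≡ σ′) × (τ ≡ τ′)
⊕-injective {a} {b} σ σ′ τ τ′ e =
  word-ext σ σ′ (λ j p → trans (sym (val-⊕ˡ σ τ p)) (trans (cong (λ v → val v j) e) (val-⊕ˡ σ′ τ′ p)))
  , word-ext τ τ′ (λ j p → NP.+-cancelˡ-≡ a _ _
      (trans (sym (val-⊕ʳ σ τ p)) (trans (cong (λ v → val v (a + j)) e) (val-⊕ʳ σ′ τ′ p))))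

isPermℕ-⊕ˡ : ∀ {a b} (σ : Word a) (τ : Word b) → IsPermℕ (σ ⊕ τ) → IsPermℕ σ
isPermℕ-⊕ˡ {a} {b} σ τ (inj , surj) =
  (λ i j p q e → inj i j (widen p) (widen q) (trans (val-⊕ˡ σ τ p) (trans e (sym (val-⊕ˡ σ τ q)))))
  , λ y p → preimage y p (surj y (widen p))
  where
  widen : ∀ {i} → i < a → i < a + b
  widen p = NP.<-≤-trans p (NP.m≤m+n a b)
  -- a value below a can only be taken in the σ-part
  preimage : ∀ y → y < a → (Σ ℕ λ i → (i < a + b) × (val (σ ⊕ τ) i ≡ y)) → Σ ℕ λ i → (i < a) × (val σ i ≡ y)
  preimage y p (i , q , e) with i NP.<? a
  ... | yes r = i , r , trans (sym (val-⊕ˡ σ τ r)) e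
  ... | no r  = ⊥-elim (NP.<⇒≱ p (subst (a ≤_) e (≤val-⊕ʳ σ τ (NP.≮⇒≥ r) q)))

isPermℕ-⊕ʳ : ∀ {a b} (σ : Word a) (τ : Word b) → IsPermℕ (σ ⊕ τ) → IsPermℕ τ
isPermℕ-⊕ʳ {a} {b} σ τ (inj , surj) =
  (λ i j p q e → NP.+-cancelˡ-≡ a _ _ (inj (a + i) (a + j) (NP.+-monoʳ-< a p) (NP.+-monoʳ-< a q)
      (trans (val-⊕ʳ σ τ p) (trans (cong (_+_ a) e) (sym (val-⊕ʳ σ τ q))))))
  , λ y p → preimage y p (surj (a + y) (NP.+-monoʳ-< a p))
  where
  -- a value ≥ a can only be taken in the τ-part
  preimage : ∀ y → y < b → (Σ ℕ λ i → (i < a + b) × (val (σ ⊕ τ) i ≡ a + y)) → Σ ℕ λ i → (i < b) × (val τ i ≡ y)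
  preimage y p (i , q , e) with i NP.<? a
  ... | yes r = ⊥-elim (NP.<⇒≱ (val< σ r) (subst (a ≤_) (sym (trans (sym (val-⊕ˡ σ τ r)) e)) (NP.m≤m+n a y)))
  ... | no r  = i ∸ a , ∸-< (NP.≮⇒≥ r) q , NP.+-cancelˡ-≡ a _ _ (trans (sym (val-⊕ʳ′ σ τ (NP.≮⇒≥ r) q)) e)

contains-⊕ˡ : ∀ {a b} (σ : Word a) (τ : Word b) → Contains (σ ⊕ τ) σ
contains-⊕ˡ {a} {b} σ τ = (λ i → i ↑ˡ b) ,
  (λ x y p → subst₂ _<_ (sym (FP.toℕ-↑ˡ x b)) (sym (FP.toℕ-↑ˡ y b)) p) ,
  λ x y → mk⇔ (subst₂ _<_ (sym (value x)) (sym (value y))) (subst₂ _<_ (value x) (value y))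
  where
  value : ∀ x → toℕ (lookup (σ ⊕ τ) (x ↑ˡ b)) ≡ toℕ (lookup σ x)
  value x = trans (cong toℕ (lookup-⊕ˡ σ τ x)) (FP.toℕ-↑ˡ _ b)

contains-⊕ʳ : ∀ {a b} (σ : Word a) (τ : Word b) → Contains (σ ⊕ τ) τ
contains-⊕ʳ {a} {b} σ τ = (λ i → a ↑ʳ i) ,
  (λ x y p → subst₂ _<_ (sym (FP.toℕ-↑ʳ a x)) (sym (FP.toℕ-↑ʳ a y)) (NP.+-monoʳ-< a p)) ,
  λ x y → mk⇔ (λ p → subst₂ _<_ (sym (value x)) (sym (value y)) (NP.+-monoʳ-< a p))
              (λ p → NP.+-cancelˡ-< a _ _ (subst₂ _<_ (value x) (value y) p))
  where
  value : ∀ x → toℕ (lookup (σ ⊕ τ) (a ↑ʳ x)) ≡ a + toℕ (lookup τ x)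
  value x = trans (cong toℕ (lookup-⊕ʳ σ τ x)) (FP.toℕ-↑ʳ a _)

-- σ ⊕ τ as a word of a length n that is only propositionally equal to a + b.
sumAt : ∀ {a b n} → a + b ≡ n → Word a → Word b → Word n
sumAt e σ τ = subst Word e (σ ⊕ τ)

sumAt-injective : ∀ {a b n} (e e′ : a + b ≡ n) (σ σ′ : Word a) (τ τ′ : Word b)
  → sumAt e σ τ ≡ sumAt e′ σ′ τ′ → (σ ≡ σ′) × (τ ≡ τ′)
sumAt-injective refl refl σ σ′ τ τ′ eq = ⊕-injective σ σ′ τ τ′ eq

sumAt-irrelevant : ∀ {a b n} (e e′ : a + b ≡ n) (σ : Word a) (τ : Word b) → sumAt e σ τ ≡ sumAt e′ σ τ
sumAt-irrelevant e e′ σ τ = cong (λ e → sumAt e σ τ) (NP.≡-irrelevant e e′)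

val-sumAtˡ : ∀ {a b n} (e : a + b ≡ n) (σ : Word a) (τ : Word b) {j} → j < a → val (sumAt e σ τ) j ≡ val σ j
val-sumAtˡ refl = val-⊕ˡ

val-sumAtʳ : ∀ {a b n} (e : a + b ≡ n) (σ : Word a) (τ : Word b) {j} → j < b → val (sumAt e σ τ) (a + j) ≡ a + val τ j
val-sumAtʳ refl = val-⊕ʳ

-- Cuts.  π has a cut at c when its first c positions carry exactly the
-- values below c; cuts at 0 < c < n are exactly the ways of writing π
-- as a sum of two nonempty words.

CutAt : ∀ {n} → Word n → ℕ → ℕ → Set
CutAt π c j = (j < c → val π j < c) × (c ≤ j → c ≤ val π j)

Cut : ∀ {n} → Word n → ℕ → Set
Cut {n} π c = ∀ {j} → j < n → CutAt π c j

cut? : ∀ {n} (π : Word n) c → Dec (Cut π c)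
cut? {n} π c = NP.allUpTo? (λ j → ((j NP.<? c) →-dec (val π j NP.<? c)) ×-dec ((c NP.≤? j) →-dec (c NP.≤? val π j))) n

cut-full : ∀ {n} (π : Word n) → Cut π n
cut-full π p = (λ _ → val< π p) , λ q → ⊥-elim (NP.<⇒≱ p q)

cut-⊕ : ∀ {a b} (σ : Word a) (τ : Word b) → Cut (σ ⊕ τ) a
cut-⊕ {a} σ τ {j} q with j NP.<? a
... | yes r = (λ _ → subst (_< a) (sym (val-⊕ˡ σ τ r)) (val< σ r)) , λ s → ⊥-elim (NP.<⇒≱ r s)
... | no r  = (λ s → ⊥-elim (r s)) , λ s → ≤val-⊕ʳ σ τ s q

cut-⊕-extend : ∀ {a b c} (σ : Word a) (τ : Word b) → c ≤ a → Cut σ c → Cut (σ ⊕ τ) c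
cut-⊕-extend {a} {b} {c} σ τ c≤a cut {j} q with j NP.<? a
... | yes r = (λ s → subst (_< c) (sym (val-⊕ˡ σ τ r)) (proj₁ (cut r) s))
            , λ s → subst (c ≤_) (sym (val-⊕ˡ σ τ r)) (proj₂ (cut r) s)
... | no r  = (λ s → ⊥-elim (NP.<⇒≱ s (NP.≤-trans c≤a (NP.≮⇒≥ r))))
            , λ _ → NP.≤-trans c≤a (≤val-⊕ʳ σ τ (NP.≮⇒≥ r) q)

cut-⊕-restrict : ∀ {a b c} (σ : Word a) (τ : Word b) → Cut (σ ⊕ τ) c → Cut σ c
cut-⊕-restrict {a} {b} {c} σ τ cut {j} r =
  (λ s → subst (_< c) (val-⊕ˡ σ τ r) (proj₁ (cut (NP.<-≤-trans r (NP.m≤m+n a b))) s))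
  , λ s → subst (c ≤_) (val-⊕ˡ σ τ r) (proj₂ (cut (NP.<-≤-trans r (NP.m≤m+n a b))) s)

cut-sumAt : ∀ {a b n} (e : a + b ≡ n) (σ : Word a) (τ : Word b) → Cut (sumAt e σ τ) a
cut-sumAt refl = cut-⊕

cut-sumAt-restrict : ∀ {a b n c} (e : a + b ≡ n) (σ : Word a) (τ : Word b) → Cut (sumAt e σ τ) c → Cut σ c
cut-sumAt-restrict refl = cut-⊕-restrict

split-at-cut : ∀ {n} a b (e : a + b ≡ n) (π : Word n) → Cut π a
  → Σ (Word a) λ σ → Σ (Word b) λ τ → sumAt e σ τ ≡ π
split-at-cut a b refl π cut = σ , τ , word-ext (σ ⊕ τ) π same-values
  where
  widen : ∀ {j} → j < a → j < a + b
  widen p = NP.<-≤-trans p (NP.m≤m+n a b)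
  shift< : ∀ {j} → j < b → a + j < a + b
  shift< = NP.+-monoʳ-< a
  σ : Word a
  σ = tabulate λ i → fromℕ< (proj₁ (cut (widen (FP.toℕ<n i))) (FP.toℕ<n i))
  τ : Word b
  τ = tabulate λ i → fromℕ< {val π (a + toℕ i) ∸ a}
        (∸-< (proj₂ (cut (shift< (FP.toℕ<n i))) (NP.m≤m+n a _)) (val< π (shift< (FP.toℕ<n i))))
  val-σ : ∀ {j} (p : j < a) → val σ j ≡ val π j
  val-σ p = trans (val-lookup σ p) (trans (cong toℕ (VP.lookup∘tabulate _ (fromℕ< p)))
              (trans (FP.toℕ-fromℕ< _) (cong (val π) (FP.toℕ-fromℕ< p))))
  val-τ : ∀ {j} (p : j < b) → val τ j ≡ val π (a + j) ∸ a
  val-τ p = trans (val-lookup τ p) (trans (cong toℕ (VP.lookup∘tabulate _ (fromℕ< p)))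
              (trans (FP.toℕ-fromℕ< _) (cong (λ x → val π (a + x) ∸ a) (FP.toℕ-fromℕ< p))))
  same-values : ∀ j → j < a + b → val (σ ⊕ τ) j ≡ val π j
  same-values j q with j NP.<? a
  ... | yes r = trans (val-⊕ˡ σ τ r) (val-σ r)
  ... | no r  = let s = NP.≮⇒≥ r in begin
      val (σ ⊕ τ) j                   ≡⟨ val-⊕ʳ′ σ τ s q ⟩
      a + val τ (j ∸ a)               ≡⟨ cong (_+_ a) (val-τ (∸-< s q)) ⟩
      a + (val π (a + (j ∸ a)) ∸ a)   ≡⟨ cong (λ x → a + (val π x ∸ a)) (NP.m+[n∸m]≡n s) ⟩
      a + (val π j ∸ a)               ≡⟨ NP.m+[n∸m]≡n (proj₂ (cut q) s) ⟩
      val π j                         ∎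
    where open ≡-Reasoning

to-sumAt : (P : ∀ n → Word n → Set) → ∀ {a b n} (e : a + b ≡ n) (σ : Word a) (τ : Word b)
  → P (a + b) (σ ⊕ τ) → P n (sumAt e σ τ)
to-sumAt P refl σ τ x = x

from-sumAt : (P : ∀ n → Word n → Set) → ∀ {a b n} (e : a + b ≡ n) (σ : Word a) (τ : Word b)
  → P n (sumAt e σ τ) → P (a + b) (σ ⊕ τ)
from-sumAt P refl σ τ x = x

decompose-at-cut : ∀ {n} a b (e : suc a + suc b ≡ n) (π : Word n) → IsPermℕ π → Cut π (suc a) → ¬ Indecomposable π
decompose-at-cut a b e π perm cut indec =
  indec (a , b , σ , τ , isPermℕ⇒ σ (isPermℕ-⊕ˡ σ τ perm-⊕) , isPermℕ⇒ τ (isPermℕ-⊕ʳ σ τ perm-⊕) , e , eq)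
  where
  parts = split-at-cut (suc a) (suc b) e π cut
  σ = proj₁ parts
  τ = proj₁ (proj₂ parts)
  eq = proj₂ (proj₂ parts)
  perm-⊕ : IsPermℕ (σ ⊕ τ)
  perm-⊕ = from-sumAt (λ _ → IsPermℕ) e σ τ (subst IsPermℕ (sym eq) perm)

no-inner-cut : ∀ {k c} (α : Word k) → IsPermℕ α → Indecomposable α → Cut α c → 0 < c → c < k → ⊥
no-inner-cut {k} {suc c} α perm indec cut _ c<k with k ∸ suc c in eq
... | zero  = NP.<⇒≱ c<k (NP.m∸n≡0⇒m≤n eq)
... | suc b = decompose-at-cut c b (trans (cong (_+_ (suc c)) (sym eq)) (NP.m+[n∸m]≡n (NP.<⇒≤ c<k))) α perm cut indec

least : {P : ℕ → Set} → (∀ c → Dec (P c)) → ∀ {b} → P b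
  → Σ ℕ λ c → (c ≤ b) × P c × (∀ {c′} → c′ < c → ¬ P c′)
least {P} P? {b} = <-rec (λ b → P b → Σ ℕ λ c → (c ≤ b) × P c × (∀ {c′} → c′ < c → ¬ P c′)) step b
  where
  step : ∀ b → (∀ {b′} → b′ < b → P b′ → Σ ℕ λ c → (c ≤ b′) × P c × (∀ {c′} → c′ < c → ¬ P c′))
       → P b → Σ ℕ λ c → (c ≤ b) × P c × (∀ {c′} → c′ < c → ¬ P c′)
  step b smaller pb with NP.anyUpTo? P? b
  ... | no none = b , NP.≤-refl , pb , λ c′<b pc′ → none (_ , c′<b , pc′)
  ... | yes (c , c<b , pc) =
    let (c₀ , c₀≤c , pc₀ , minimal) = smaller c<b pc in c₀ , NP.≤-trans c₀≤c (NP.<⇒≤ c<b) , pc₀ , minimal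

FirstCut : ∀ {n} → Word n → ℕ → Set
FirstCut π k = Cut π (suc k) × (∀ {c} → c < k → ¬ Cut π (suc c))

first-cut : ∀ {m} (π : Word (suc m)) → Σ ℕ λ k → (k ≤ m) × FirstCut π k
first-cut π = let (k , k≤m , cut , minimal) = least (λ c → cut? π (suc c)) (cut-full π) in k , k≤m , cut , minimal

-- The block before the first cut is indecomposable: a splitting of it
-- would produce an earlier cut of π.
first-block-indecomposable : ∀ {n k b} (e : suc k + b ≡ n) (α : Word (suc k)) (ρ : Word b) (π : Word n)
  → sumAt e α ρ ≡ π → FirstCut π k → Indecomposable α
first-block-indecomposable {k = k} e α ρ π eq (_ , minimal) (a₁ , b₁ , σ₁ , τ₁ , _ , _ , e₁ , eq₁) =
  minimal a₁<k cut-π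
  where
  a₁<k : a₁ < k
  a₁<k = NP.≤-pred (subst (suc a₁ <_) e₁ (NP.m<m+n (suc a₁) z<s))
  cut-α : Cut α (suc a₁)
  cut-α = subst (λ w → Cut w (suc a₁)) eq₁ (cut-sumAt e₁ σ₁ τ₁)
  cut-π : Cut π (suc a₁)
  cut-π = subst (λ w → Cut w (suc a₁)) eq
            (to-sumAt (λ _ w → Cut w (suc a₁)) e α ρ (cut-⊕-extend α ρ (s≤s (NP.<⇒≤ a₁<k)) cut-α))

cut-of : ∀ {n k k′ b b′} (α : Word k) (ρ : Word b) (α′ : Word k′) (ρ′ : Word b′)
  (e : k + b ≡ n) (e′ : k′ + b′ ≡ n) → sumAt e α ρ ≡ sumAt e′ α′ ρ′ → Cut α′ k
cut-of {k = k} α ρ α′ ρ′ e e′ eq = cut-sumAt-restrict e′ α′ ρ′ (subst (λ w → Cut w k) eq (cut-sumAt e α ρ))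

first-block-unique : ∀ {n k k′ b b′} (α : Word (suc k)) (ρ : Word b) (α′ : Word (suc k′)) (ρ′ : Word b′)
  (e : suc k + b ≡ n) (e′ : suc k′ + b′ ≡ n)
  → IsPermℕ α → Indecomposable α → IsPermℕ α′ → Indecomposable α′
  → sumAt e α ρ ≡ sumAt e′ α′ ρ′ → k ≡ k′
first-block-unique {k = k} {k′} α ρ α′ ρ′ e e′ perm indec perm′ indec′ eq with NP.<-cmp k k′
... | tri≈ _ k≡k′ _ = k≡k′
... | tri< k<k′ _ _ = ⊥-elim (no-inner-cut α′ perm′ indec′ (cut-of α ρ α′ ρ′ e e′ eq) z<s (s≤s k<k′))
... | tri> _ _ k′<k = ⊥-elim (no-inner-cut α perm indec (cut-of α′ ρ′ α ρ e′ e (sym eq)) z<s (s≤s k′<k))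

-- The bijection ⊕π of ℤ.  With n = m + 1, every y : ℤ has block coordinates
-- y = (j + 1) + q·n with j < n, and ⊕π(y) = (π(j) + 1) + q·n.

no-gap : ∀ {n r r′} k → r′ < n → + r′ ≡ + r Z.+ + suc k Z.* + n → ⊥
no-gap {n} {r} {r′} k r′<n e = NP.<⇒≱ r′<n (begin
  n                 ≤⟨ NP.m≤m+n n (k * n) ⟩
  suc k * n         ≤⟨ NP.m≤n+m (suc k * n) r ⟩
  r + suc k * n     ≡⟨ ZP.+-injective (trans (ZP.pos-+ r (suc k * n)) (trans (cong (Z._+_ (+ r)) (ZP.pos-* (suc k) n)) (sym e))) ⟩
  r′                ∎)
  where open NP.≤-Reasoning

rebalance : ∀ a b q q′ n → a Z.+ q Z.* n ≡ b Z.+ q′ Z.* n → b ≡ a Z.+ (q Z.- q′) Z.* n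
rebalance a b q q′ n e = trans (isolate b q′ n) (trans (cong (Z._- q′ Z.* n) (sym e)) (regroup a q q′ n))
  where
  isolate : ∀ b q′ n → b ≡ (b Z.+ q′ Z.* n) Z.- q′ Z.* n
  isolate = solve-∀
  regroup : ∀ a q q′ n → (a Z.+ q Z.* n) Z.- q′ Z.* n ≡ a Z.+ (q Z.- q′) Z.* n
  regroup = solve-∀

quotient-unique : ∀ n r r′ q q′ → r < n → r′ < n → + r Z.+ q Z.* + n ≡ + r′ Z.+ q′ Z.* + n → q ≡ q′
quotient-unique n r r′ q q′ r<n r′<n eq with q Z.- q′ in δ | q′ Z.- q in δ′
... | + zero    | _         = ZP.i-j≡0⇒i≡j q q′ δ
... | + suc k   | _         = ⊥-elim (no-gap k r′<n (trans (rebalance (+ r) (+ r′) q q′ (+ n) eq) (cong (λ d → + r Z.+ d Z.* + n) δ)))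
... | -[1+ _ ]  | + zero    = sym (ZP.i-j≡0⇒i≡j q′ q δ′)
... | -[1+ _ ]  | + suc k   = ⊥-elim (no-gap k r<n (trans (rebalance (+ r′) (+ r) q′ q (+ n) (sym eq)) (cong (λ d → + r′ Z.+ d Z.* + n) δ′)))
... | -[1+ k ]  | -[1+ k′ ] = ⊥-elim (negative≢0 (trans (cong₂ Z._+_ (sym δ) (sym δ′)) (cancel q q′)))
  where
  cancel : ∀ q q′ → (q Z.- q′) Z.+ (q′ Z.- q) ≡ + 0
  cancel = solve-∀
  negative≢0 : -[1+ k ] Z.+ -[1+ k′ ] ≢ + 0
  negative≢0 ()

blocks : ∀ m (y : ℤ) → Σ ℕ λ j → Σ ℤ λ q → (j < suc m) × (y ≡ + suc j Z.+ q Z.* + suc m)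
blocks m y = x %ℕ suc m , x /ℕ suc m , n%ℕd<d x (suc m) ,
  trans (sym (predecessor y)) (trans (cong (Z._+_ (+ 1)) (a≡a%ℕn+[a/ℕn]*n x (suc m))) (regroup (+ (x %ℕ suc m)) (x /ℕ suc m) (+ suc m)))
  where
  x = y Z.- + 1
  predecessor : ∀ y → + 1 Z.+ (y Z.- + 1) ≡ y
  predecessor = solve-∀
  regroup : ∀ a b c → + 1 Z.+ (a Z.+ b Z.* c) ≡ (+ 1 Z.+ a) Z.+ b Z.* c
  regroup = solve-∀

oplus-block : ∀ {m} (π : Word (suc m)) j q → j < suc m
  → oplusZ π (+ suc j Z.+ q Z.* + suc m) ≡ + suc (val π j) Z.+ q Z.* + suc m
oplus-block {m} π j q j<n =
  trans (cong₂ (λ a b → (+ a Z.+ + 1) Z.+ b Z.* + suc m)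
              (trans (sym (val-lookup π (n%ℕd<d x (suc m)))) (cong (val π) remainder)) quotient)
        (cong (Z._+ q Z.* + suc m) (ZP.+-comm (+ val π j) (+ 1)))
  where
  x = (+ suc j Z.+ q Z.* + suc m) Z.- + 1
  predecessor : ∀ a q n → ((+ 1 Z.+ a) Z.+ q Z.* n) Z.- + 1 ≡ a Z.+ q Z.* n
  predecessor = solve-∀
  division : + (x %ℕ suc m) Z.+ (x /ℕ suc m) Z.* + suc m ≡ + j Z.+ q Z.* + suc m
  division = trans (sym (a≡a%ℕn+[a/ℕn]*n x (suc m))) (predecessor (+ j) q (+ suc m))
  quotient : x /ℕ suc m ≡ q
  quotient = quotient-unique (suc m) _ j _ q (n%ℕd<d x (suc m)) j<n division
  remainder : x %ℕ suc m ≡ j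
  remainder = ZP.+-injective (trans (rebalance (+ j) (+ (x %ℕ suc m)) q (x /ℕ suc m) (+ suc m) (sym division))
                (trans (cong (λ d → + j Z.+ d Z.* + suc m) (trans (cong (Z._-_ q) quotient) (ZP.+-inverseʳ q)))
                       (no-term (+ j) (+ suc m))))
    where
    no-term : ∀ a n → a Z.+ + 0 Z.* n ≡ a
    no-term = solve-∀

oplus-at : ∀ {m} (π : Word (suc m)) j → j < suc m → oplusZ π (+ suc j) ≡ + suc (val π j)
oplus-at {m} π j j<n = trans (cong (oplusZ π) (sym (no-term (+ suc j) (+ suc m))))
                             (trans (oplus-block π j (+ 0) j<n) (no-term _ (+ suc m)))
  where
  no-term : ∀ a n → a Z.+ + 0 Z.* n ≡ a
  no-term = solve-∀

oplus-injective : ∀ {m} (π π′ : Word (suc m)) → oplusZ π ≗ℤ oplusZ π′ → π ≡ π′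
oplus-injective π π′ same = word-ext π π′ λ j j<n →
  NP.suc-injective (ZP.+-injective (trans (sym (oplus-at π j j<n)) (trans (same (+ suc j)) (oplus-at π′ j j<n))))

≗-by-blocks : ∀ m (f g : ℤ → ℤ) → (∀ j q → j < suc m → f (+ suc j Z.+ q Z.* + suc m) ≡ g (+ suc j Z.+ q Z.* + suc m)) → f ≗ℤ g
≗-by-blocks m f g agree y with blocks m y
... | j , q , j<n , refl = agree j q j<n

oplus-periodic : ∀ {m} (π : Word (suc m)) q y → oplusZ π (y Z.+ q Z.* + suc m) ≡ oplusZ π y Z.+ q Z.* + suc m
oplus-periodic {m} π q y with blocks m y
... | j , q′ , j<n , refl = begin
  oplusZ π ((+ suc j Z.+ q′ Z.* n) Z.+ q Z.* n)   ≡⟨ cong (oplusZ π) (merge (+ suc j) q′ q n) ⟩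
  oplusZ π (+ suc j Z.+ (q′ Z.+ q) Z.* n)         ≡⟨ oplus-block π j (q′ Z.+ q) j<n ⟩
  + suc (val π j) Z.+ (q′ Z.+ q) Z.* n            ≡⟨ sym (merge (+ suc (val π j)) q′ q n) ⟩
  (+ suc (val π j) Z.+ q′ Z.* n) Z.+ q Z.* n      ≡⟨ cong (Z._+ q Z.* n) (sym (oplus-block π j q′ j<n)) ⟩
  oplusZ π (+ suc j Z.+ q′ Z.* n) Z.+ q Z.* n     ∎
  where
  open ≡-Reasoning
  n = + suc m
  merge : ∀ a q′ q n → (a Z.+ q′ Z.* n) Z.+ q Z.* n ≡ a Z.+ (q′ Z.+ q) Z.* n
  merge = solve-∀

Positive NonPositive : ℤ → Set
Positive y    = Σ ℕ λ a → y ≡ + suc a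
NonPositive y = Σ ℕ λ a → y ≡ Z.- + a

positive-nonpositive : ∀ {y} → Positive y → NonPositive y → ⊥
positive-nonpositive (a , refl) (zero  , ())
positive-nonpositive (a , refl) (suc b , ())

block-positive : ∀ {n} j k → Positive (+ suc j Z.+ + k Z.* + n)
block-positive {n} j k = j + k * n , cong (Z._+_ (+ suc j)) (sym (ZP.pos-* k n))

block-nonpositive : ∀ {n j} k → j < n → NonPositive (+ suc j Z.+ -[1+ k ] Z.* + n)
block-nonpositive {n} {j} k j<n = suc k * n ∸ suc j , (begin
  + suc j Z.+ -[1+ k ] Z.* + n          ≡⟨ cong (Z._+_ (+ suc j)) (sym (ZP.neg-distribˡ-* (+ suc k) (+ n))) ⟩
  + suc j Z.+ Z.- (+ suc k Z.* + n)     ≡⟨ cong (λ z → + suc j Z.+ Z.- z) (sym (ZP.pos-* (suc k) n)) ⟩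
  + suc j Z.+ Z.- + (suc k * n)         ≡⟨ ZP.m-n≡m⊖n (suc j) (suc k * n) ⟩
  suc j ⊖ suc k * n                     ≡⟨ ZP.⊖-≤ (NP.≤-trans j<n (NP.m≤m+n n (k * n))) ⟩
  Z.- + (suc k * n ∸ suc j)             ∎)
  where open ≡-Reasoning

oplus-sign : ∀ {m} (π : Word (suc m)) y
  → (Positive y × Positive (oplusZ π y)) ⊎ (NonPositive y × NonPositive (oplusZ π y))
oplus-sign {m} π y with blocks m y
... | j , + k , j<n , refl =
  inj₁ (block-positive j k , subst Positive (sym (oplus-block π j (+ k) j<n)) (block-positive (val π j) k))
... | j , -[1+ k ] , j<n , refl =
  inj₂ (block-nonpositive k j<n , subst NonPositive (sym (oplus-block π j -[1+ k ] j<n)) (block-nonpositive k (val< π j<n)))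

oplus-positive : ∀ {m} (π : Word (suc m)) {y} → Positive y → Positive (oplusZ π y)
oplus-positive π {y} pos with oplus-sign π y
... | inj₁ (_ , image)     = image
... | inj₂ (nonpos , _)    = ⊥-elim (positive-nonpositive pos nonpos)

oplus-nonpositive : ∀ {m} (π : Word (suc m)) {y} → NonPositive y → NonPositive (oplusZ π y)
oplus-nonpositive π {y} nonpos with oplus-sign π y
... | inj₁ (pos , _)       = ⊥-elim (positive-nonpositive pos nonpos)
... | inj₂ (_ , image)     = image

shift-cong : ∀ r {f g : ℤ → ℤ} → f ≗ℤ g → shiftZ r f ≗ℤ shiftZ r g
shift-cong r f≗g i = cong (Z._+ r) (f≗g (i Z.- r))

shift-amount : ∀ {r s} (f : ℤ → ℤ) → r ≡ s → shiftZ r f ≗ℤ shiftZ s f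
shift-amount f refl i = refl

shift-shift : ∀ a b (f : ℤ → ℤ) → shiftZ a (shiftZ b f) ≗ℤ shiftZ (a Z.+ b) f
shift-shift a b f i = trans (amount (f ((i Z.- a) Z.- b)) a b) (cong (λ x → f x Z.+ (a Z.+ b)) (argument i a b))
  where
  argument : ∀ i a b → (i Z.- a) Z.- b ≡ i Z.- (a Z.+ b)
  argument = solve-∀
  amount : ∀ x a b → (x Z.+ b) Z.+ a ≡ x Z.+ (a Z.+ b)
  amount = solve-∀

shift-zero : (f : ℤ → ℤ) → shiftZ (+ 0) f ≗ℤ f
shift-zero f i = trans (cong (λ x → f x Z.+ + 0) (ZP.+-identityʳ i)) (ZP.+-identityʳ (f i))

≗ℤ-sym : ∀ {f g} → f ≗ℤ g → g ≗ℤ f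
≗ℤ-sym f≗g i = sym (f≗g i)

≗ℤ-trans : ∀ {f g h} → f ≗ℤ g → g ≗ℤ h → f ≗ℤ h
≗ℤ-trans f≗g g≗h i = trans (f≗g i) (g≗h i)

shift-move : ∀ a b (f g : ℤ → ℤ) → shiftZ a f ≗ℤ shiftZ b g → f ≗ℤ shiftZ (Z.- a Z.+ b) g
shift-move a b f g eq =
  ≗ℤ-trans (≗ℤ-sym (shift-zero f))
  (≗ℤ-trans (shift-amount f (sym (ZP.+-inverseˡ a)))
  (≗ℤ-trans (≗ℤ-sym (shift-shift (Z.- a) a f))
  (≗ℤ-trans (shift-cong (Z.- a) eq) (shift-shift (Z.- a) b g))))

oplus-period : ∀ {m} (π : Word (suc m)) q → shiftZ (q Z.* + suc m) (oplusZ π) ≗ℤ oplusZ π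
oplus-period {m} π q i = begin
  oplusZ π (i Z.- q Z.* n) Z.+ q Z.* n              ≡⟨ cong (λ x → oplusZ π x Z.+ q Z.* n) (negate i q n) ⟩
  oplusZ π (i Z.+ Z.- q Z.* n) Z.+ q Z.* n          ≡⟨ cong (Z._+ q Z.* n) (oplus-periodic π (Z.- q) i) ⟩
  (oplusZ π i Z.+ Z.- q Z.* n) Z.+ q Z.* n          ≡⟨ cancel (oplusZ π i) q n ⟩
  oplusZ π i                                        ∎
  where
  open ≡-Reasoning
  n = + suc m
  negate : ∀ i q n → i Z.- q Z.* n ≡ i Z.+ Z.- q Z.* n
  negate = solve-∀
  cancel : ∀ x q n → (x Z.+ Z.- q Z.* n) Z.+ q Z.* n ≡ x
  cancel = solve-∀

-- If ⊕π′ is ⊕π shifted by d, then π′ has a cut at d: positions j < d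
-- come from non-positive arguments of ⊕π, positions j ≥ d from positive ones.
cut-from-shift : ∀ {m} (π π′ : Word (suc m)) d → oplusZ π′ ≗ℤ shiftZ (+ d) (oplusZ π) → Cut π′ d
cut-from-shift π π′ d shifted {j} j<n = below , above
  where
  v = val π′ j
  y = + suc j Z.- + d
  value : + suc v ≡ oplusZ π y Z.+ + d
  value = trans (sym (oplus-at π′ j j<n)) (shifted (+ suc j))
  below : j < d → v < d
  below j<d =
    let (a , e) = oplus-nonpositive π (d ∸ suc j , trans (ZP.m-n≡m⊖n (suc j) d) (ZP.⊖-≤ j<d))
        sum≡d : suc v + a ≡ d
        sum≡d = ZP.+-injective (trans (ZP.pos-+ (suc v) a)
                  (trans (cong (Z._+ + a) (trans value (cong (Z._+ + d) e))) (cancel (+ a) (+ d))))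
    in subst (suc v ≤_) sum≡d (NP.m≤m+n (suc v) a)
    where
    cancel : ∀ a d → (Z.- a Z.+ d) Z.+ a ≡ d
    cancel = solve-∀
  above : d ≤ j → d ≤ v
  above d≤j =
    let (a , e) = oplus-positive π (j ∸ d , trans (ZP.m-n≡m⊖n (suc j) d)
                    (trans (ZP.⊖-≥ (NP.m≤n⇒m≤1+n d≤j)) (cong +_ (NP.+-∸-assoc 1 d≤j))))
        v≡ : v ≡ a + d
        v≡ = NP.suc-injective (ZP.+-injective (trans value (trans (cong (Z._+ + d) e) (sym (ZP.pos-+ (suc a) d)))))
    in subst (d ≤_) (sym v≡) (NP.m≤n+m d a)

-- Rotation: writing π = α ⊕ ρ with |α| = c, ⊕π is ⊕(ρ ⊕ α) shifted by c,
-- because the period of ⊕π read from position c + 1 on is ρ followed by α.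
module Rotation {m c d} (e : c + d ≡ suc m) (e′ : d + c ≡ suc m) (α : Word c) (ρ : Word d) where
  open ≡-Reasoning
  π  = sumAt e α ρ
  π′ = sumAt e′ ρ α
  N  = + suc m

  N≡ : + c Z.+ + d ≡ N
  N≡ = trans (sym (ZP.pos-+ c d)) (cong +_ e)

  -- Moving back by c from inside α crosses into the previous period, as N = c + d.
  back : ∀ V Q → (V Z.+ Q Z.* N) Z.- + c ≡ (V Z.+ + d) Z.+ (Q Z.- + 1) Z.* N
  back V Q = subst (λ N → (V Z.+ Q Z.* N) Z.- + c ≡ (V Z.+ + d) Z.+ (Q Z.- + 1) Z.* N) N≡ (identity V Q (+ c) (+ d))
    where
    identity : ∀ V Q C D → (V Z.+ Q Z.* (C Z.+ D)) Z.- C ≡ (V Z.+ D) Z.+ (Q Z.- + 1) Z.* (C Z.+ D)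
    identity = solve-∀

  forth : ∀ V Q → ((V Z.+ + d) Z.+ (Q Z.- + 1) Z.* N) Z.+ + c ≡ V Z.+ Q Z.* N
  forth V Q = subst (λ N → ((V Z.+ + d) Z.+ (Q Z.- + 1) Z.* N) Z.+ + c ≡ V Z.+ Q Z.* N) N≡ (identity V Q (+ c) (+ d))
    where
    identity : ∀ V Q C D → ((V Z.+ D) Z.+ (Q Z.- + 1) Z.* (C Z.+ D)) Z.+ C ≡ V Z.+ Q Z.* (C Z.+ D)
    identity = solve-∀

  translate : ∀ V C Q → ((V Z.+ C) Z.+ Q Z.* N) Z.- C ≡ V Z.+ Q Z.* N
  translate V C Q = identity V C Q N
    where
    identity : ∀ V C Q N → ((V Z.+ C) Z.+ Q Z.* N) Z.- C ≡ V Z.+ Q Z.* N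
    identity = solve-∀

  untranslate : ∀ V C Q → (V Z.+ Q Z.* N) Z.+ C ≡ (V Z.+ C) Z.+ Q Z.* N
  untranslate V C Q = identity V C Q N
    where
    identity : ∀ V C Q N → (V Z.+ Q Z.* N) Z.+ C ≡ (V Z.+ C) Z.+ Q Z.* N
    identity = solve-∀

  in-α : ∀ j q → j < c → oplusZ π (+ suc j Z.+ q Z.* N) ≡ shiftZ (+ c) (oplusZ π′) (+ suc j Z.+ q Z.* N)
  in-α j q j<c = begin
    oplusZ π (+ suc j Z.+ q Z.* N)                                  ≡⟨ oplus-block π j q j<n ⟩
    + suc (val π j) Z.+ q Z.* N                                     ≡⟨ cong (λ v → + suc v Z.+ q Z.* N) (val-sumAtˡ e α ρ j<c) ⟩
    + suc (val α j) Z.+ q Z.* N                                     ≡⟨ sym (forth (+ suc (val α j)) q) ⟩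
    + suc (val α j + d) Z.+ (q Z.- + 1) Z.* N Z.+ + c               ≡⟨ cong (λ v → + suc v Z.+ (q Z.- + 1) Z.* N Z.+ + c) value′ ⟩
    + suc (val π′ (j + d)) Z.+ (q Z.- + 1) Z.* N Z.+ + c            ≡⟨ cong (Z._+ + c) (sym (oplus-block π′ (j + d) (q Z.- + 1) j+d<n)) ⟩
    oplusZ π′ (+ suc (j + d) Z.+ (q Z.- + 1) Z.* N) Z.+ + c         ≡⟨ cong (λ y → oplusZ π′ y Z.+ + c) (sym (back (+ suc j) q)) ⟩
    oplusZ π′ ((+ suc j Z.+ q Z.* N) Z.- + c) Z.+ + c               ∎
    where
    j<n : j < suc m
    j<n = subst (j <_) e (NP.<-≤-trans j<c (NP.m≤m+n c d))
    j+d<n : j + d < suc m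
    j+d<n = subst (j + d <_) e (NP.+-monoˡ-< d j<c)
    value′ : val α j + d ≡ val π′ (j + d)
    value′ = sym (trans (cong (val π′) (NP.+-comm j d)) (trans (val-sumAtʳ e′ ρ α j<c) (NP.+-comm d (val α j))))

  in-ρ : ∀ u q → u < d → oplusZ π (+ suc (u + c) Z.+ q Z.* N) ≡ shiftZ (+ c) (oplusZ π′) (+ suc (u + c) Z.+ q Z.* N)
  in-ρ u q u<d = begin
    oplusZ π (+ suc (u + c) Z.+ q Z.* N)                            ≡⟨ oplus-block π (u + c) q u+c<n ⟩
    + suc (val π (u + c)) Z.+ q Z.* N                               ≡⟨ cong (λ v → + suc v Z.+ q Z.* N) value ⟩
    + suc (val ρ u + c) Z.+ q Z.* N                                 ≡⟨ sym (untranslate (+ suc (val ρ u)) (+ c) q) ⟩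
    + suc (val ρ u) Z.+ q Z.* N Z.+ + c                             ≡⟨ cong (λ v → + suc v Z.+ q Z.* N Z.+ + c) (sym (val-sumAtˡ e′ ρ α u<d)) ⟩
    + suc (val π′ u) Z.+ q Z.* N Z.+ + c                            ≡⟨ cong (Z._+ + c) (sym (oplus-block π′ u q u<n)) ⟩
    oplusZ π′ (+ suc u Z.+ q Z.* N) Z.+ + c                         ≡⟨ cong (λ y → oplusZ π′ y Z.+ + c) (sym (translate (+ suc u) (+ c) q)) ⟩
    oplusZ π′ ((+ suc (u + c) Z.+ q Z.* N) Z.- + c) Z.+ + c         ∎
    where
    u<n : u < suc m
    u<n = subst (u <_) e′ (NP.<-≤-trans u<d (NP.m≤m+n d c))
    u+c<n : u + c < suc m
    u+c<n = subst (u + c <_) e′ (NP.+-monoˡ-< c u<d)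
    value : val π (u + c) ≡ val ρ u + c
    value = trans (cong (val π) (NP.+-comm u c)) (trans (val-sumAtʳ e α ρ u<d) (NP.+-comm c (val ρ u)))

oplus-rotate : ∀ {m c d} (e : c + d ≡ suc m) (e′ : d + c ≡ suc m) (α : Word c) (ρ : Word d)
  → oplusZ (sumAt e α ρ) ≗ℤ shiftZ (+ c) (oplusZ (sumAt e′ ρ α))
oplus-rotate {m} {c} {d} e e′ α ρ = ≗-by-blocks m _ _ block
  where
  open Rotation e e′ α ρ
  block : ∀ j q → j < suc m → oplusZ π (+ suc j Z.+ q Z.* N) ≡ shiftZ (+ c) (oplusZ π′) (+ suc j Z.+ q Z.* N)
  block j q j<n with j NP.<? c
  ... | yes j<c = in-α j q j<c
  ... | no j≮c  = subst (λ j → oplusZ π (+ suc j Z.+ q Z.* N) ≡ shiftZ (+ c) (oplusZ π′) (+ suc j Z.+ q Z.* N))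
                        (NP.m∸n+n≡m c≤j) (in-ρ (j ∸ c) q (∸-< c≤j (subst (j <_) (sym e) j<n)))
    where
    c≤j = NP.≮⇒≥ j≮c

-- The two counting bijections.  For a sum closed class C, every π ∈ C_{m+1}
-- splits uniquely as α ⊕ ρ with α indecomposable of size k + 1 ≤ m + 1,
-- and both summands lie in C (they are patterns of π); conversely every
-- such sum lies in C.

module Counting (C : Class) (class : IsPermClass C) (sum-closed : SumClosed C)
  (f g : ℕ → ℕ)
  (card-f : ∀ n → Card _≡_ (C n) (f n))
  (card-g : ∀ n → Card _≡_ (λ π → C n π × Indecomposable π) (g n)) where

  isPermℕ-C : ∀ {n} {π : Word n} → C n π → IsPermℕ π
  isPermℕ-C {n} {π} π∈C = isPerm⇒ℕ π (proj₁ class n π π∈C)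

  C-⊕ˡ : ∀ {a b} (σ : Word a) (τ : Word b) → C (a + b) (σ ⊕ τ) → C a σ
  C-⊕ˡ σ τ c = proj₂ class _ _ (σ ⊕ τ) σ c (isPermℕ⇒ σ (isPermℕ-⊕ˡ σ τ (isPermℕ-C c))) (contains-⊕ˡ σ τ)

  C-⊕ʳ : ∀ {a b} (σ : Word a) (τ : Word b) → C (a + b) (σ ⊕ τ) → C b τ
  C-⊕ʳ σ τ c = proj₂ class _ _ (σ ⊕ τ) τ c (isPermℕ⇒ τ (isPermℕ-⊕ʳ σ τ (isPermℕ-C c))) (contains-⊕ʳ σ τ)

  C-sumAt : ∀ {a b n} (e : a + b ≡ n) {σ : Word a} {τ : Word b} → C a σ → C b τ → C n (sumAt e σ τ)
  C-sumAt e {σ} {τ} cσ cτ = to-sumAt C e σ τ (sum-closed _ _ σ τ cσ cτ)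

  Cₙ : ℕ → Finite
  Cₙ n = fromCard _≡_ (C n) (f n) sym trans (card-f n)

  Indecₙ : ℕ → Finite
  Indecₙ n = fromCard _≡_ (λ π → C n π × Indecomposable π) (g n) sym trans (card-g n)

  Blocks : ℕ → ℕ → Finite
  Blocks m k = Indecₙ (suc k) ×ᶠ Cₙ (m ∸ k)

  module Split m = DisjointUnion (Blocks m)

  Decomposition : ℕ → Set
  Decomposition m = Split.Below m (suc m)

  block-length : ∀ {m k} → k < suc m → suc k + (m ∸ k) ≡ suc m
  block-length k<n = cong suc (NP.m+[n∸m]≡n (NP.≤-pred k<n))

  glue : ∀ m → Decomposition m → Word (suc m)
  glue m (k , k<n , ((α , _) , (ρ , _))) = sumAt (block-length k<n) α ρ

  glue∈C : ∀ m x → C (suc m) (glue m x)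
  glue∈C m (k , k<n , ((α , α∈C , _) , (ρ , ρ∈C))) = C-sumAt (block-length k<n) α∈C ρ∈C

  glue-reflects : ∀ m {x y} → glue m x ≡ glue m y → Split._≋_ m x y
  glue-reflects m {k , p , ((α , α∈C , α-indec) , (ρ , _))} {k′ , p′ , ((α′ , α′∈C , α′-indec) , (ρ′ , _))} eq
    with first-block-unique α ρ α′ ρ′ _ _ (isPermℕ-C α∈C) α-indec (isPermℕ-C α′∈C) α′-indec eq
  ... | refl = refl , sumAt-injective (block-length p) (block-length p′) α α′ ρ ρ′ eq

  glue-preserves : ∀ m {x y} → Split._≋_ m x y → glue m x ≡ glue m y
  glue-preserves m {k , p , ((α , _) , (ρ , _))} {.k , p′ , ((.α , _) , (.ρ , _))} (refl , refl , refl) =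
    sumAt-irrelevant (block-length p) (block-length p′) α ρ

  decompose : ∀ m (π : Word (suc m)) → C (suc m) π → Σ (Decomposition m) λ x → glue m x ≡ π
  decompose m π π∈C =
    (k , k<n , ((α , C-⊕ˡ α ρ α⊕ρ∈C , first-block-indecomposable e α ρ π eq first) , (ρ , C-⊕ʳ α ρ α⊕ρ∈C))) , eq
    where
    found = first-cut π
    k = proj₁ found
    k<n : k < suc m
    k<n = s≤s (proj₁ (proj₂ found))
    first : FirstCut π k
    first = proj₂ (proj₂ found)
    e = block-length k<n
    parts = split-at-cut (suc k) (m ∸ k) e π (proj₁ first)
    α = proj₁ parts
    ρ = proj₁ (proj₂ parts)
    eq = proj₂ (proj₂ parts)
    α⊕ρ∈C : C (suc k + (m ∸ k)) (α ⊕ ρ)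
    α⊕ρ∈C = from-sumAt C e α ρ (subst (C (suc m)) (sym eq) π∈C)

  count-C : ∀ m → sumBelow (suc m) (λ k → g (suc k) * f (m ∸ k)) ≡ f (suc m)
  count-C m = size-≡ (Split.finite-Below m (suc m)) (Cₙ (suc m)) (λ x → glue m x , glue∈C m x)
    (λ {x} {y} → glue-reflects m {x} {y}) (λ {x} {y} → glue-preserves m {x} {y}) (λ (π , π∈C) → decompose m π π∈C) sym trans

  count-C₀ : C 0 [] → 1 ≡ f 0
  count-C₀ []∈C = size-≡ (finite-Fin 1) (Cₙ 0) (λ _ → [] , []∈C) (λ _ → unique-Fin1 _ _) (λ _ → refl)
    (λ { ([] , _) → F.zero , refl }) sym trans
    where
    unique-Fin1 : (x y : Fin 1) → x ≡ y
    unique-Fin1 F.zero F.zero = refl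

  ShiftedBlocks : ℕ → ℕ → Finite
  ShiftedBlocks m k = finite-Fin (suc k) ×ᶠ Blocks m k

  module Shifted m = DisjointUnion (ShiftedBlocks m)

  ShiftedDecomposition : ℕ → Set
  ShiftedDecomposition m = Shifted.Below m (suc m)

  unshift : ∀ m → ShiftedDecomposition m → Decomposition m
  unshift m (k , p , (_ , x)) = k , p , x

  amount : ∀ m → ShiftedDecomposition m → ℕ
  amount m (_ , _ , (t , _)) = toℕ t

  unroll : ∀ m → ShiftedDecomposition m → ℤ → ℤ
  unroll m x = shiftZ (Z.- + amount m x) (oplusZ (glue m (unshift m x)))

  -- Σ^{-t}(⊕π) = Σ^{-t′}(⊕π′) with t < t′ would put a cut at t′ − t inside the
  -- indecomposable first block of π′, which has size greater than t′.
  amount-reflects : ∀ m (x y : ShiftedDecomposition m) → unroll m x ≗ℤ unroll m y → amount m x < amount m y → ⊥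
  amount-reflects m (k , p , (t , ((α , _) , (ρ , _))))
                    (k′ , p′ , (t′ , ((α′ , α′∈C , α′-indec) , (ρ′ , _)))) same t<t′ =
    no-inner-cut α′ (isPermℕ-C α′∈C) α′-indec cut-α′ (NP.m<n⇒0<n∸m t<t′) d<k′
    where
    d = toℕ t′ ∸ toℕ t
    d<k′ : d < suc k′
    d<k′ = NP.≤-<-trans (NP.m∸n≤m (toℕ t′) (toℕ t)) (FP.toℕ<n t′)
    π  = sumAt (block-length p) α ρ
    π′ = sumAt (block-length p′) α′ ρ′
    amount≡ : Z.- (Z.- + toℕ t′) Z.+ Z.- + toℕ t ≡ + d
    amount≡ = trans (cong (Z._+ Z.- + toℕ t) (ZP.neg-involutive (+ toℕ t′)))
                (trans (ZP.m-n≡m⊖n (toℕ t′) (toℕ t)) (ZP.⊖-≥ (NP.<⇒≤ t<t′)))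
    shifted : oplusZ π′ ≗ℤ shiftZ (+ d) (oplusZ π)
    shifted = ≗ℤ-trans (shift-move (Z.- + toℕ t′) (Z.- + toℕ t) (oplusZ π′) (oplusZ π) (≗ℤ-sym same)) (shift-amount (oplusZ π) amount≡)
    cut-α′ : Cut α′ d
    cut-α′ = cut-sumAt-restrict (block-length p′) α′ ρ′ (cut-from-shift π π′ d shifted)

  amount-unique : ∀ m (x y : ShiftedDecomposition m) → unroll m x ≗ℤ unroll m y → amount m x ≡ amount m y
  amount-unique m x y same with NP.<-cmp (amount m x) (amount m y)
  ... | tri< lt _ _ = ⊥-elim (amount-reflects m x y same lt)
  ... | tri≈ _ eq _ = eq
  ... | tri> _ _ gt = ⊥-elim (amount-reflects m y x (≗ℤ-sym same) gt)

  unroll-reflects : ∀ m {x y} → unroll m x ≗ℤ unroll m y → Shifted._≋_ m x y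
  unroll-reflects m {x@(k , p , (t , a))} {y@(k′ , p′ , (t′ , a′))} same =
    assemble (glue-reflects m {k , p , a} {k′ , p′ , a′} (oplus-injective π π′ same-oplus)) (amount-unique m x y same)
    where
    π  = glue m (k , p , a)
    π′ = glue m (k′ , p′ , a′)
    s = Z.- + toℕ t
    same-shift : shiftZ s (oplusZ π) ≗ℤ shiftZ s (oplusZ π′)
    same-shift = ≗ℤ-trans same (shift-amount (oplusZ π′) (cong (λ a → Z.- + a) (sym (amount-unique m x y same))))
    same-oplus : oplusZ π ≗ℤ oplusZ π′
    same-oplus = ≗ℤ-trans (shift-move s s (oplusZ π) (oplusZ π′) same-shift)
                   (≗ℤ-trans (shift-amount (oplusZ π′) (ZP.+-inverseˡ s)) (shift-zero (oplusZ π′)))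
    assemble : Split._≋_ m (k , p , a) (k′ , p′ , a′) → toℕ t ≡ toℕ t′ → Shifted._≋_ m x y
    assemble (refl , a≋a′) t≡t′ = refl , FP.toℕ-injective t≡t′ , a≋a′

  unroll-preserves : ∀ m {x y} → Shifted._≋_ m x y → unroll m x ≗ℤ unroll m y
  unroll-preserves m {k , p , (t , a)} {.k , p′ , (.t , a′)} (refl , refl , a≋a′) =
    shift-cong (Z.- + toℕ t) (λ i → cong (λ π → oplusZ π i) (glue-preserves m {k , p , a} {k , p′ , a′} (refl , a≋a′)))

  -- Every Σ^{-u}(⊕π) with π ∈ C and u ≥ 0 is unrolled from a shifted
  -- decomposition: if u is below the size k + 1 of the first block take t = u,
  -- otherwise rotate π = α ⊕ ρ to ρ ⊕ α (still in C) and decrease u by k + 1.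
  reach : ∀ m u (π : Word (suc m)) → C (suc m) π
    → Σ (ShiftedDecomposition m) λ x → unroll m x ≗ℤ shiftZ (Z.- + u) (oplusZ π)
  reach m = <-rec Goal (λ u smaller π π∈C → from-first-block u smaller π (decompose m π π∈C))
    where
    Goal : ℕ → Set
    Goal u = ∀ π → C (suc m) π → Σ (ShiftedDecomposition m) λ x → unroll m x ≗ℤ shiftZ (Z.- + u) (oplusZ π)
    from-first-block : ∀ u → (∀ {u′} → u′ < u → Goal u′) → ∀ π → Σ (Decomposition m) (λ x → glue m x ≡ π)
      → Σ (ShiftedDecomposition m) λ x → unroll m x ≗ℤ shiftZ (Z.- + u) (oplusZ π)
    from-first-block u smaller π ((k , p , blocks@((α , α∈C , _) , (ρ , ρ∈C))) , eq) = by-size (u NP.<? suc k)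
      where
      by-size : Dec (u < suc k) → Σ (ShiftedDecomposition m) λ x → unroll m x ≗ℤ shiftZ (Z.- + u) (oplusZ π)
      by-size (yes u≤k) = (k , p , (fromℕ< u≤k , blocks)) ,
        λ i → cong₂ (λ a π → shiftZ (Z.- + a) (oplusZ π) i) (FP.toℕ-fromℕ< u≤k) eq
      by-size (no u≰k)  = let (x , unrolled) = smaller u′<u π′ π′∈C in x , ≗ℤ-trans unrolled rotated
        where
        k<u = NP.≮⇒≥ u≰k
        e′ : (m ∸ k) + suc k ≡ suc m
        e′ = trans (NP.+-comm (m ∸ k) (suc k)) (block-length p)
        π′ = sumAt e′ ρ α
        π′∈C = C-sumAt e′ ρ∈C α∈C
        u′<u : u ∸ suc k < u
        u′<u = NP.∸-monoʳ-< {u} {suc k} {0} z<s k<u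
        amount≡ : Z.- + u Z.+ + suc k ≡ Z.- + (u ∸ suc k)
        amount≡ = trans (ZP.-m+n≡n⊖m u (suc k)) (ZP.⊖-≤ k<u)
        rotated : shiftZ (Z.- + (u ∸ suc k)) (oplusZ π′) ≗ℤ shiftZ (Z.- + u) (oplusZ π)
        rotated = ≗ℤ-sym
          (≗ℤ-trans (shift-cong (Z.- + u) (λ i → cong (λ π → oplusZ π i) (sym eq)))
          (≗ℤ-trans (shift-cong (Z.- + u) (oplus-rotate (block-length p) e′ α ρ))
          (≗ℤ-trans (shift-shift (Z.- + u) (+ suc k) (oplusZ π′))
                    (shift-amount (oplusZ π′) amount≡))))

  -- Each element Σ^r(⊕π) of ⊕C_{m+1} is Σ^{-u}(⊕π) for some u ≥ 0, since ⊕π has period n.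
  unroll-onto : ∀ m (h : Σ (ℤ → ℤ) (OplusClass C m)) → Σ (ShiftedDecomposition m) λ x → unroll m x ≗ℤ proj₁ h
  unroll-onto m (h , π , π∈C , r , h≗) = x , ≗ℤ-trans unrolled (≗ℤ-sym (≗ℤ-trans h≗ periodic))
    where
    N = + suc m
    u = (Z.- r) %ℕ suc m
    q = (Z.- r) /ℕ suc m
    reached = reach m u π π∈C
    x = proj₁ reached
    unrolled = proj₂ reached
    r≡ : r ≡ Z.- + u Z.+ (Z.- q) Z.* N
    r≡ = trans (sym (ZP.neg-involutive r)) (trans (cong Z.-_ (a≡a%ℕn+[a/ℕn]*n (Z.- r) (suc m))) (negate (+ u) q N))
      where
      negate : ∀ u q n → Z.- (u Z.+ q Z.* n) ≡ Z.- u Z.+ (Z.- q) Z.* n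
      negate = solve-∀
    periodic : shiftZ r (oplusZ π) ≗ℤ shiftZ (Z.- + u) (oplusZ π)
    periodic = ≗ℤ-trans (shift-amount (oplusZ π) r≡)
               (≗ℤ-trans (≗ℤ-sym (shift-shift (Z.- + u) ((Z.- q) Z.* N) (oplusZ π)))
                         (shift-cong (Z.- + u) (oplus-period π (Z.- q))))

  count-oplus : ∀ m {size⊕} → Card _≗ℤ_ (OplusClass C m) size⊕
    → sumBelow (suc m) (λ k → suc k * (g (suc k) * f (m ∸ k))) ≡ size⊕
  count-oplus m {size⊕} card = size-≡ (Shifted.finite-Below m (suc m))
    (fromCard _≗ℤ_ (OplusClass C m) size⊕ ≗ℤ-sym ≗ℤ-trans card)
    (λ x → unroll m x , glue m (unshift m x) , glue∈C m (unshift m x) , Z.- + amount m x , λ _ → refl)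
    (λ {x} {y} → unroll-reflects m {x} {y}) (λ {x} {y} → unroll-preserves m {x} {y}) (unroll-onto m) ≗ℤ-sym ≗ℤ-trans

theorem2p4 : (C : Class) → IsPermClass C → SumClosed C → C 0 []
    → (f g f̃ : ℕ → ℕ)
    → (∀ n → Card _≡_ (C n) (f n))
    → (∀ n → Card _≡_ (λ π → C n π × Indecomposable π) (g n))
    → (∀ m → Card _≗ℤ_ (OplusClass C m) (f̃ (suc m)))
    → (∀ n → pos f̃ n ≡ X (D (pos g) · f) n)
      × (∀ n → (pos f̃ · f) n ≡ X (D f) n)
theorem2p4 C class sum-closed []∈C f g f̃ card-f card-g card-f̃ = F̃≡xG′F , F̃F≡xF′
  where
  open Counting C class sum-closed f g card-f card-g

  F̃≡xG′F : ∀ n → pos f̃ n ≡ X (D (pos g) · f) n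
  F̃≡xG′F zero    = refl
  F̃≡xG′F (suc m) = sym (trans (sum-cong (suc m) λ k _ → NP.*-assoc (suc k) (g (suc k)) (f (m ∸ k)))
                              (count-oplus m (card-f̃ m)))

  renewal : f ≐ (one ⊞ (pos g · f))
  renewal zero    = sym (count-C₀ []∈C)
  renewal (suc m) = sym (trans (sum-first (suc m) _) (count-C m))

  F̃F≡xF′ : ∀ n → (pos f̃ · f) n ≡ X (D f) n
  F̃F≡xF′ zero    = refl
  F̃F≡xF′ (suc m) = begin
    (pos f̃ · f) (suc m)                                          ≡⟨ sum-first (suc m) _ ⟩
    sumBelow (suc m) (λ k → f̃ (suc k) * f (m ∸ k))                ≡⟨ sum-cong (suc m) (λ k _ → cong (_* f (m ∸ k)) (F̃≡xG′F (suc k))) ⟩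
    ((D (pos g) · f) · f) m                                       ≡⟨ sym (derivative-of-renewal f (pos g) refl renewal m) ⟩
    D f m                                                         ∎
    where open ≡-Reasoning
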